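{- Let $G$ be a connected bipartite graph with $|V(G)|=|E(G)|$, and let $G'=K_1\vee G$ with universal vertex $v_1$. Let $f(v_1)=1$ and $f(v)=3$ for all $v\in V(G)$. Then for every good prime $f$-cover $\mathcal{H}$ of $G'$ of order $3$, there is an $\mathcal{H}$-coloring of $G'$.
   Context: All graphs are finite and simple. $K_1\vee G$ is obtained by adding one new vertex (the universal vertex) adjacent to all vertices of $G$. A cover of a graph $G$ is a pair $\mathcal{H}=(L,H)$ where $H$ is a graph and $L:V(G)\to\mathcal{P}(V(H))$ satisfies: (1) $\{L(u)\}$ partitions $V(H)$; (2) each $H[L(u)]$ is complete; (3) if $E_H(L(u),L(v))\neq\emptyset$ then $u=v$ or $uv\in E(G)$; (4) if $uv\in E(G)$ then $E_H(L(u),L(v))$ is a matching (possibly empty). An $\mathcal{H}$-coloring is an independent set of $H$ of size $|V(G)|$. $\mathcal{H}$ is an $f$-cover if $|L(u)|=f(u)$ for all $u$. For a prime power $t$, a prime cover of order $t$ is a cover with $|L(v)|\le t$ for all $v$, with vertices named so that $L(v)\subseteq\{(v,j):j\in\mathbb{F}_t\}$. Fix an ordering $v_1,\dots,v_n$ of the vertices. For an edge $v_iv_j$, $j>i$, the saturation function $\sigma_{v_iv_j}$ maps each $q\in\mathbb{F}_t$ with $(v_i,q)$ saturated by $E_H(L(v_i),L(v_j))$ to the unique $r$ with $(v_i,q)(v_j,r)\in E(H)$; it is good if $q-\sigma_{v_iv_j}(q)$ is the same element of $\mathbb{F}_t$ for all $q$ in its domain (vacuously good if the domain is empty). The prime cover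 is good if some naming of the vertices of $H$ with $L(v)\subseteq\{(v,j):j\in\mathbb{F}_t\}$ makes every saturation function good. -}

module Defs where

open import Data.Nat using (ℕ; zero; suc; _+_; _∸_; _<ᵇ_; _<_)
open import Data.Nat.DivMod using (_mod_)
open import Data.Bool using (Bool; true; false; _∧_; if_then_else_)
open import Data.Fin using (Fin; zero; suc; toℕ)
open import Data.Fin.Subset using (Subset; _∈_; ∣_∣)
open import Data.List using (List; map)
open import Data.Nat.ListAction using (sum)
open import Data.List using (allFin)
open import Data.Product using (Σ; ∃; _×_; _,_)
open import Relation.Binary.PropositionalEquality using (_≡_; _≢_)
open import Relation.Nullary using (¬_)
open import Function.Definitions using (Injective)

record SimpleGraph (n : ℕ) : Set where
  field
    adj     : Fin n → Fin n → Bool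
    sym     : ∀ i j → adj i j ≡ adj j i
    irrefl  : ∀ i → adj i i ≡ false
open SimpleGraph public

Adj : ∀ {n} → SimpleGraph n → Fin n → Fin n → Set
Adj G i j = adj G i j ≡ true

ΣFin : ∀ n → (Fin n → ℕ) → ℕ
ΣFin n f = sum (map f (allFin n))

numEdges : ∀ {n} → SimpleGraph n → ℕ
numEdges {n} G =
  ΣFin n (λ i → ΣFin n (λ j → if (toℕ i <ᵇ toℕ j) ∧ adj G i j then 1 else 0))

data Walk {n} (G : SimpleGraph n) : Fin n → Fin n → Set where
  here : ∀ {u} → Walk G u u
  step : ∀ {u v w} → Adj G u v → Walk G v w → Walk G u w

Connected : ∀ {n} → SimpleGraph n → Set
Connected {n} G = ∀ (u v : Fin n) → Walk G u v

Bipartite : ∀ {n} → SimpleGraph n → Set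
Bipartite {n} G = Σ (Fin n → Bool) λ c → ∀ i j → Adj G i j → c i ≢ c j

joinAdj : ∀ {n} → SimpleGraph n → Fin (suc n) → Fin (suc n) → Bool
joinAdj G zero    zero    = false
joinAdj G zero    (suc _) = true
joinAdj G (suc _) zero    = true
joinAdj G (suc i) (suc j) = adj G i j

joinSym : ∀ {n} (G : SimpleGraph n) i j → joinAdj G i j ≡ joinAdj G j i
joinSym G zero    zero    = Relation.Binary.PropositionalEquality.refl
joinSym G zero    (suc _) = Relation.Binary.PropositionalEquality.refl
joinSym G (suc _) zero    = Relation.Binary.PropositionalEquality.refl
joinSym G (suc i) (suc j) = sym G i j

joinIrrefl : ∀ {n} (G : SimpleGraph n) i → joinAdj G i i ≡ false
joinIrrefl G zero    = Relation.Binary.PropositionalEquality.refl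
joinIrrefl G (suc i) = irrefl G i

K₁∨_ : ∀ {n} → SimpleGraph n → SimpleGraph (suc n)
K₁∨ G = record { adj = joinAdj G ; sym = joinSym G ; irrefl = joinIrrefl G }

F₃ : Set
F₃ = Fin 3

_-₃_ : F₃ → F₃ → F₃
a -₃ b = (toℕ a + (3 ∸ toℕ b)) mod 3

-- Prime covers of order 3.
-- The vertices of H are named (v , j) with j ∈ L v ⊆ F₃; H is given by
-- the lists L and an edge relation E on such names.

record PrimeCover3 {m} (G : SimpleGraph m) : Set₁ where
  field
    L  : Fin m → Subset 3
    E  : Fin m → F₃ → Fin m → F₃ → Set
    E-dom    : ∀ u j v k → E u j v k → j ∈ L u × k ∈ L v
    E-sym    : ∀ u j v k → E u j v k → E v k u j
    E-irrefl : ∀ u j → ¬ E u j u j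
    E-clique : ∀ u j k → j ∈ L u → k ∈ L u → j ≢ k → E u j u k
    E-adj    : ∀ u j v k → u ≢ v → E u j v k → Adj G u v
    E-match₁ : ∀ u j v k k′ → u ≢ v → E u j v k → E u j v k′ → k ≡ k′
    E-match₂ : ∀ u j j′ v k → u ≢ v → E u j v k → E u j′ v k → j ≡ j′
open PrimeCover3 public

IsFCover : ∀ {m} {G : SimpleGraph m} → PrimeCover3 G → (Fin m → ℕ) → Set
IsFCover {m} H f = ∀ (u : Fin m) → ∣ L H u ∣ ≡ f u

-- Good: some renaming (an injective renaming of the names of each list,
-- equivalently a permutation of F₃ per vertex) makes every saturation
-- function σ_{uv} (u before v in the ordering) good, i.e. q - σ(q) constant.
Good : ∀ {m} {G : SimpleGraph m} → PrimeCover3 G → Set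
Good {m} {G} H =
  Σ (Fin m → F₃ → F₃) λ π →
    (∀ v → Injective _≡_ _≡_ (π v)) ×
    (∀ (u v : Fin m) → toℕ u < toℕ v → Adj G u v →
       ∃ λ (d : F₃) → ∀ (j k : F₃) → E H u j v k → (π u j -₃ π v k) ≡ d)

-- H-coloring: an independent set of H of size |V(G)|.
-- A set of vertices of H is given by I u ⊆ L u for each u.
IsHColoring : ∀ {m} {G : SimpleGraph m} → (H : PrimeCover3 G) → (Fin m → Subset 3) → Set
IsHColoring {m} H I =
  (∀ u j → j ∈ I u → j ∈ L H u) ×
  (∀ u j v k → j ∈ I u → k ∈ I v → ¬ E H u j v k) ×
  (ΣFin m (λ u → ∣ I u ∣) ≡ m)

HasHColoring : ∀ {m} {G : SimpleGraph m} → PrimeCover3 G → Set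
HasHColoring {m} H = Σ (Fin m → Subset 3) (IsHColoring H)

fProp : ∀ {n} → Fin (suc n) → ℕ
fProp zero    = 1
fProp (suc _) = 3

module Submission where

-- G has as many edges as vertices, so a breadth-first spanning tree of G misses exactly one
-- edge ab (counting edges at their deeper endpoint; bipartiteness rules out edges inside a
-- layer). Reversing the tree path from a to the root and giving a the in-edge from b orients G
-- so that every vertex has exactly one in-neighbour.
--
-- After renaming, the universal vertex blocks one value at each v of G, leaving two values,
-- which we index by a Boolean twisted by the side of v in the bipartition. A constraint
-- π p − π q ≠ δ along an edge then forbids at most one pair of Booleans, or exactly the
-- unequal pairs (a finite check over F₃), so for each vertex either copying the colour of its
-- in-neighbour is safe or some colour is safe against every colour of the in-neighbour.
-- Colouring each vertex like the first vertex of its backward walk that has such an absolutely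
-- safe colour satisfies all constraints; a cycle of copying vertices is coloured constantly.

open import Data.Bool using (Bool; true; false; _∧_; _xor_; not; T; if_then_else_)
import Data.Bool.Properties as Bool
open import Data.Fin using (Fin; zero; suc; toℕ; punchIn; punchOut)
import Data.Fin.Properties as Fin
open import Data.Fin.Subset using (Subset; _∈_; ∣_∣; ⁅_⁆; Nonempty)
open import Data.Fin.Subset.Properties
  using (nonempty?; Empty-unique; ∣⊥∣≡0; x∈⁅y⁆⇒x≡y; ∣⁅x⁆∣≡1; ∣p∣≡n⇒p≡⊤; ∈⊤)
open import Data.List using (tabulate)
open import Data.List.Properties using (map-tabulate)
open import Data.Nat
  using (ℕ; zero; suc; _+_; _*_; _∸_; _≤_; _<_; _≤′_; _≤?_; _<?_; _≟_; _<ᵇ_; pred; z≤n; s≤s; s≤s⁻¹; z<s; ≤′-refl; ≤′-step)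
open import Data.Nat.GeneralisedArithmetic using (fold; iterate)
open import Data.Nat.ListAction using () renaming (sum to sumᴸ)
open import Data.Nat.Properties
open import Algebra.Properties.CommutativeMonoid.Sum +-0-commutativeMonoid
  using (sum-syntax; ∑-comm; ∑-distrib-+; sum-cong-≗; sum-remove)
open import Data.Product using (∃; ∃₂; _×_; _,_; proj₁; proj₂)
open import Data.Sum using (_⊎_; inj₁; inj₂)
import Data.Sum as Sum
open import Function using (_∘_; id; flip; case_of_)
open import Function.Definitions using (Injective)
open import Relation.Binary using (tri<; tri≈; tri>)
open import Relation.Binary.PropositionalEquality
open import Relation.Nullary using (¬_; contradiction; Dec; yes; no; toSum)
open import Relation.Nullary.Decidable
  using (_×-dec_; _⊎-dec_; ⌊_⌋; toWitness; fromWitness; map′; from-yes; ¬?)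

open import Defs hiding (sym)

private
  variable
    n : ℕ

ΣFin≡∑ : ∀ n (f : Fin n → ℕ) → ΣFin n f ≡ ∑[ i < n ] f i
ΣFin≡∑ n f = trans (cong sumᴸ (map-tabulate id f)) (sum-tabulate n f)
  where
  sum-tabulate : ∀ n (f : Fin n → ℕ) → sumᴸ (tabulate f) ≡ ∑[ i < n ] f i
  sum-tabulate zero    f = refl
  sum-tabulate (suc n) f = cong (f zero +_) (sum-tabulate n (f ∘ suc))

term≤∑ : (f : Fin n → ℕ) (i : Fin n) → f i ≤ ∑[ j < n ] f j
term≤∑ {suc n} f i = subst (f i ≤_) (sym (sum-remove {i = i} f)) (m≤m+n (f i) _)

∑≡0⇒≡0 : (f : Fin n → ℕ) → ∑[ i < n ] f i ≡ 0 → ∀ i → f i ≡ 0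
∑≡0⇒≡0 f ∑f≡0 i = n≤0⇒n≡0 (subst (f i ≤_) ∑f≡0 (term≤∑ f i))

∑≡1⇒unique-support : (f : Fin n → ℕ) → ∑[ i < n ] f i ≡ 1 →
  ∃ λ x → f x ≡ 1 × ∀ y → 0 < f y → y ≡ x
∑≡1⇒unique-support {suc n} f ∑f≡1 with f zero in f₀≡
... | zero =
  let x , fx≡1 , unique = ∑≡1⇒unique-support (f ∘ suc) ∑f≡1 in
  suc x , fx≡1 , λ where
    zero    0<f₀ → contradiction f₀≡ (>⇒≢ 0<f₀)
    (suc y) 0<fy → cong suc (unique y 0<fy)
... | suc zero = zero , f₀≡ , λ where
    zero    _    → refl
    (suc y) 0<fy → contradiction (∑≡0⇒≡0 (f ∘ suc) (suc-injective ∑f≡1) y) (>⇒≢ 0<fy)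
∑≡1⇒unique-support {suc n} f () | suc (suc _)

∑∑≡1⇒unique-support : ∀ {m} (f : Fin n → Fin m → ℕ) → ∑[ i < n ] ∑[ j < m ] f i j ≡ 1 →
  ∃₂ λ i j → 0 < f i j × ∀ i′ j′ → 0 < f i′ j′ → i′ ≡ i × j′ ≡ j
∑∑≡1⇒unique-support {m = m} f ∑∑f≡1
  with i , ∑fi≡1 , unique-i ← ∑≡1⇒unique-support (λ i → ∑[ j < m ] f i j) ∑∑f≡1
  with j , fij≡1 , unique-j ← ∑≡1⇒unique-support (f i) ∑fi≡1
  = i , j , subst (0 <_) (sym fij≡1) z<s , unique
  where
  unique : ∀ i′ j′ → 0 < f i′ j′ → i′ ≡ i × j′ ≡ j
  unique i′ j′ 0<f with refl ← unique-i i′ (<-≤-trans 0<f (term≤∑ (f i′) j′)) = refl , unique-j j′ 0<f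

∑-ones : ∀ n → ∑[ i < n ] 1 ≡ n
∑-ones zero    = refl
∑-ones (suc n) = cong suc (∑-ones n)

bit : Bool → ℕ
bit b = if b then 1 else 0

module OrientedCount (A : Fin n → Fin n → Bool) (A-sym : ∀ i j → A i j ≡ A j i) where

  Orients : (Fin n → Fin n → Bool) → Set
  Orients P = ∀ i j → A i j ≡ true → bit (P i j) + bit (P j i) ≡ 1

  orients : ∀ P → (∀ i j → A i j ≡ true → T (P i j) ⊎ T (P j i)) →
    (∀ i j → T (P i j) → ¬ T (P j i)) → Orients P
  orients P total asym i j Aij with P i j in Pij | P j i in Pji | total i j Aij
  ... | true  | false | _      = refl
  ... | false | true  | _      = refl
  ... | false | false | inj₁ ()
  ... | false | false | inj₂ ()
  ... | true  | true  | _      = contradiction (subst T (sym Pji) _) (asym i j (subst T (sym Pij) _))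

  #oriented : (Fin n → Fin n → Bool) → ℕ
  #oriented P = ∑[ i < n ] ∑[ j < n ] bit (P i j ∧ A i j)

  #oriented-twice : ∀ P → Orients P → 2 * #oriented P ≡ ∑[ i < n ] ∑[ j < n ] bit (A i j)
  #oriented-twice P orients = begin
    2 * #oriented P
      ≡⟨ cong (#oriented P +_) (+-identityʳ _) ⟩
    #oriented P + #oriented P
      ≡⟨ cong (#oriented P +_) (∑-comm (λ i j → bit (P i j ∧ A i j))) ⟩
    #oriented P + ∑[ i < n ] ∑[ j < n ] bit (P j i ∧ A j i)
      ≡⟨ cong (#oriented P +_) (sum-cong-≗ λ i → sum-cong-≗ λ j → cong (λ b → bit (P j i ∧ b)) (A-sym j i)) ⟩
    #oriented P + ∑[ i < n ] ∑[ j < n ] bit (P j i ∧ A i j)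
      ≡⟨ sym (∑-distrib-+ (λ i → ∑[ j < n ] bit (P i j ∧ A i j)) _) ⟩
    ∑[ i < n ] (∑[ j < n ] bit (P i j ∧ A i j) + ∑[ j < n ] bit (P j i ∧ A i j))
      ≡⟨ sum-cong-≗ (λ i → sym (∑-distrib-+ (λ j → bit (P i j ∧ A i j)) _)) ⟩
    ∑[ i < n ] ∑[ j < n ] (bit (P i j ∧ A i j) + bit (P j i ∧ A i j))
      ≡⟨ sum-cong-≗ (λ i → sum-cong-≗ λ j → one-direction i j) ⟩
    ∑[ i < n ] ∑[ j < n ] bit (A i j) ∎
    where
    open ≡-Reasoning
    one-direction : ∀ i j → bit (P i j ∧ A i j) + bit (P j i ∧ A i j) ≡ bit (A i j)
    one-direction i j with A i j in Aij
    ... | false = absent (P i j) (P j i)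
      where
      absent : ∀ p q → bit (p ∧ false) + bit (q ∧ false) ≡ 0
      absent false false = refl
      absent false true  = refl
      absent true  false = refl
      absent true  true  = refl
    ... | true with P i j | P j i | orients i j Aij
    ...   | false | true  | _ = refl
    ...   | true  | false | _ = refl
    ...   | false | false | ()
    ...   | true  | true  | ()

  #oriented-unique : ∀ P Q → Orients P → Orients Q → #oriented P ≡ #oriented Q
  #oriented-unique P Q orients-P orients-Q =
    *-cancelˡ-≡ _ _ 2 (trans (#oriented-twice P orients-P) (sym (#oriented-twice Q orients-Q)))

adj-sym : (G : SimpleGraph n) → ∀ {u v} → Adj G u v → Adj G v u
adj-sym G {u} {v} = trans (SimpleGraph.sym G v u)

adj⇒≢ : (G : SimpleGraph n) → ∀ {u v} → Adj G u v → u ≢ v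
adj⇒≢ G {u} uu refl = case trans (sym uu) (irrefl G u) of λ ()

module BreadthFirst (G : SimpleGraph n) (r : Fin n) (reach : ∀ v → Walk G r v) where

  Within : ℕ → Fin n → Set
  Within zero    v = v ≡ r
  Within (suc k) v = Within k v ⊎ ∃ λ u → Within k u × Adj G u v

  within? : ∀ k v → Dec (Within k v)
  within? zero    v = v Fin.≟ r
  within? (suc k) v = within? k v ⊎-dec Fin.any? (λ u → within? k u ×-dec (adj G u v Bool.≟ true))

  within-mono : ∀ {j k v} → j ≤′ k → Within j v → Within k v
  within-mono ≤′-refl        w = w
  within-mono (≤′-step j≤k) w = inj₁ (within-mono j≤k w)

  walk⇒within : ∀ {k u w} → Within k u → Walk G u w → ∃ λ k′ → Within k′ w
  walk⇒within {k} w here         = k , w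
  walk⇒within     w (step a walk) = walk⇒within (inj₂ (_ , w , a)) walk

  least : ∀ {v} K → Within K v → ∃ λ k → Within k v × ∀ j → j < k → ¬ Within j v
  least zero w = zero , w , λ _ ()
  least {v} (suc K) w with within? K v
  ... | yes w′ = least K w′
  ... | no ¬w  = suc K , w , λ j j<1+K wj → ¬w (within-mono (≤⇒≤′ (s≤s⁻¹ j<1+K)) wj)

  shortest : ∀ v → ∃ λ k → Within k v × ∀ j → j < k → ¬ Within j v
  shortest v = let K , w = walk⇒within refl (reach v) in least K w

  depth : Fin n → ℕ
  depth v = proj₁ (shortest v)

  depth-within : ∀ v → Within (depth v) v
  depth-within v = proj₁ (proj₂ (shortest v))

  within⇒depth≤ : ∀ {k v} → Within k v → depth v ≤ k
  within⇒depth≤ {k} {v} w = ≮⇒≥ λ k<depth → proj₂ (proj₂ (shortest v)) k k<depth w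

  depth-root : depth r ≡ 0
  depth-root = n≤0⇒n≡0 (within⇒depth≤ {0} refl)

  depth≡0⇒root : ∀ {v} → depth v ≡ 0 → v ≡ r
  depth≡0⇒root {v} d≡0 = subst (λ k → Within k v) d≡0 (depth-within v)

  depth-adj : ∀ {u v} → Adj G u v → depth v ≤ suc (depth u)
  depth-adj {u} a = within⇒depth≤ (inj₂ (u , depth-within u , a))

  parent-exists : ∀ {k v} → depth v ≡ suc k → ∃ λ u → Adj G u v × depth u ≡ k
  parent-exists {k} {v} d≡1+k with subst (λ k → Within k v) d≡1+k (depth-within v)
  ... | inj₁ w = contradiction (within⇒depth≤ w) (<⇒≱ (≤-reflexive (sym d≡1+k)))
  ... | inj₂ (u , w , a) = u , a , ≤-antisym (within⇒depth≤ w) k≤du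
    where
    k≤du : k ≤ depth u
    k≤du = ≮⇒≥ λ du<k → <⇒≱ (subst (suc (depth u) <_) (sym d≡1+k) (s≤s du<k)) (depth-adj a)

  module _ (c : Fin n → Bool) (proper : ∀ i j → Adj G i j → c i ≢ c j) where

    colour-by-depth : ∀ k {v} → depth v ≡ k → c v ≡ fold (c r) not k
    colour-by-depth zero d≡0 = cong c (depth≡0⇒root d≡0)
    colour-by-depth (suc k) d≡1+k with parent-exists d≡1+k
    ... | u , a , du≡k = trans (Bool.¬-not (proper u _ a ∘ sym)) (cong not (colour-by-depth k du≡k))

    adjacent-depth-step : ∀ {u v} → Adj G u v → suc (depth u) ≡ depth v ⊎ suc (depth v) ≡ depth u
    adjacent-depth-step {u} {v} a with <-cmp (depth u) (depth v)
    ... | tri< du<dv _ _ = inj₁ (≤-antisym du<dv (depth-adj a))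
    ... | tri≈ _ du≡dv _ = contradiction (trans (colour-by-depth _ refl) (sym (colour-by-depth _ (sym du≡dv)))) (proper u v a)
    ... | tri> _ _ dv<du = inj₂ (≤-antisym dv<du (depth-adj (adj-sym G a)))

record FunctionalOrientation (G : SimpleGraph n) : Set where
  field
    from     : Fin n → Fin n
    from-adj : ∀ v → Adj G (from v) v
    covers   : ∀ u v → Adj G u v → from v ≡ u ⊎ from u ≡ v

n<m⇒m∸n≡suc[m∸suc[n]] : ∀ {m n} → n < m → m ∸ n ≡ suc (m ∸ suc n)
n<m⇒m∸n≡suc[m∸suc[n]] {suc m} {zero}  _         = refl
n<m⇒m∸n≡suc[m∸suc[n]] {suc m} {suc n} (s≤s n<m) = n<m⇒m∸n≡suc[m∸suc[n]] n<m

-- The spine is the tree path from a up to the root; its edges are reversed and a receives its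
-- in-edge from b, all other vertices keep their tree parent.
module PathReversal
  (G : SimpleGraph n) (root : Fin n) (parent : Fin n → Fin n) (depth : Fin n → ℕ)
  (depth-parent : ∀ v → depth (parent v) ≡ depth v ∸ 1)
  (depth≡0⇒root : ∀ {v} → depth v ≡ 0 → v ≡ root)
  (parent-adj : ∀ {v} → 0 < depth v → Adj G (parent v) v)
  (adjacent-depth-step : ∀ {x y} → Adj G x y → suc (depth x) ≡ depth y ⊎ suc (depth y) ≡ depth x)
  (a b : Fin n) (ab : Adj G a b)
  (downward : ∀ {x y} → Adj G x y → suc (depth x) ≡ depth y → x ≡ parent y ⊎ (x ≡ a × y ≡ b))
  where

  ancestor : ℕ → Fin n → Fin n
  ancestor k v = fold v parent k

  depth-ancestor : ∀ k v → depth (ancestor k v) ≡ depth v ∸ k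
  depth-ancestor zero    v = refl
  depth-ancestor (suc k) v =
    trans (depth-parent _) (trans (cong pred (depth-ancestor k v)) (pred[m∸n]≡m∸[1+n] (depth v) k))

  spine : ℕ → Fin n
  spine t = ancestor (depth a ∸ t) a

  depth-spine : ∀ {t} → t ≤ depth a → depth (spine t) ≡ t
  depth-spine {t} t≤da = trans (depth-ancestor (depth a ∸ t) a) (m∸[m∸n]≡n t≤da)

  spine-top : spine (depth a) ≡ a
  spine-top = cong (λ k → ancestor k a) (n∸n≡0 (depth a))

  parent-spine : ∀ {t} → t < depth a → parent (spine (suc t)) ≡ spine t
  parent-spine t<da = cong (λ k → ancestor k a) (sym (n<m⇒m∸n≡suc[m∸suc[n]] t<da))

  OnSpine : Fin n → Set
  OnSpine v = depth v ≤ depth a × spine (depth v) ≡ v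

  onSpine? : ∀ v → Dec (OnSpine v)
  onSpine? v = (depth v ≤? depth a) ×-dec (spine (depth v) Fin.≟ v)

  root-on-spine : ∀ {v} → depth v ≡ 0 → OnSpine v
  root-on-spine {v} d≡0 =
    subst (_≤ depth a) (sym d≡0) z≤n ,
    trans (cong spine d≡0) (trans (depth≡0⇒root (depth-spine z≤n)) (sym (depth≡0⇒root d≡0)))

  from′ : ∀ {v} → Dec (OnSpine v) → Dec (depth v ≡ depth a) → Fin n
  from′ {v} (no _)  _       = parent v
  from′     (yes _) (yes _) = b
  from′ {v} (yes _) (no _)  = spine (suc (depth v))

  from : Fin n → Fin n
  from v = from′ (onSpine? v) (depth v ≟ depth a)

  from-top : ∀ {v} → OnSpine v → depth v ≡ depth a → from v ≡ b
  from-top {v} on top with onSpine? v | depth v ≟ depth a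
  ... | yes _  | yes _    = refl
  ... | yes _  | no below = contradiction top below
  ... | no off | _        = contradiction on off

  from-below : ∀ {v} → OnSpine v → depth v ≢ depth a → from v ≡ spine (suc (depth v))
  from-below {v} on below with onSpine? v | depth v ≟ depth a
  ... | yes _  | yes top = contradiction top below
  ... | yes _  | no _    = refl
  ... | no off | _       = contradiction on off

  from-a : from a ≡ b
  from-a = from-top (≤-refl , spine-top) refl

  from-adj : ∀ v → Adj G (from v) v
  from-adj v with onSpine? v
  ... | no off = parent-adj (n≢0⇒n>0 λ d≡0 → off (root-on-spine d≡0))
  ... | yes on@(dv≤da , spine≡v) with depth v ≟ depth a
  ...   | yes top = subst (Adj G b) v≡a (adj-sym G ab)
    where
    v≡a : a ≡ v
    v≡a = trans (sym spine-top) (trans (cong spine (sym top)) spine≡v)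
  ...   | no below = subst (Adj G _) parent≡v (adj-sym G parent-edge)
    where
    dv<da : depth v < depth a
    dv<da = ≤∧≢⇒< dv≤da below
    parent≡v : parent (spine (suc (depth v))) ≡ v
    parent≡v = trans (parent-spine dv<da) spine≡v
    parent-edge : Adj G (parent (spine (suc (depth v)))) (spine (suc (depth v)))
    parent-edge = parent-adj (subst (0 <_) (sym (depth-spine dv<da)) z<s)

  covers-downward : ∀ {x y} → Adj G x y → suc (depth x) ≡ depth y → from y ≡ x ⊎ from x ≡ y
  covers-downward {x} {y} xy down with downward xy down
  ... | inj₂ (refl , refl) = inj₂ from-a
  ... | inj₁ x≡parent with onSpine? y
  ...   | no _ = inj₁ (sym x≡parent)
  ...   | yes (dy≤da , spine≡y) = inj₂ (trans (from-below x-on (<⇒≢ dx<da)) (trans (cong spine down) spine≡y))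
    where
    dx<da : depth x < depth a
    dx<da = subst (_≤ depth a) (sym down) dy≤da
    x-on : OnSpine x
    x-on = <⇒≤ dx<da , (begin
      spine (depth x)               ≡⟨ parent-spine dx<da ⟨
      parent (spine (suc (depth x))) ≡⟨ cong (parent ∘ spine) down ⟩
      parent (spine (depth y))      ≡⟨ cong parent spine≡y ⟩
      parent y                      ≡⟨ x≡parent ⟨
      x                             ∎)
      where open ≡-Reasoning

  orientation : FunctionalOrientation G
  orientation = record { from = from ; from-adj = from-adj ; covers = covers }
    where
    covers : ∀ u v → Adj G u v → from v ≡ u ⊎ from u ≡ v
    covers u v uv with adjacent-depth-step uv
    ... | inj₁ down = covers-downward uv down
    ... | inj₂ up   = Sum.swap (covers-downward (adj-sym G uv) up)

module UnicyclicOrientation {m} (G : SimpleGraph (suc m)) (r : Fin (suc m)) (connected : Connected G)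
  (c : Fin (suc m) → Bool) (proper : ∀ i j → Adj G i j → c i ≢ c j) (#edges : numEdges G ≡ suc m)
  where

  open BreadthFirst G r (connected r)
  open OrientedCount (adj G) (SimpleGraph.sym G)

  parent-step : ∀ v → ∃ λ u → depth u ≡ depth v ∸ 1 × (0 < depth v → Adj G u v)
  parent-step v with depth v in d≡
  ... | zero  = v , d≡ , λ ()
  ... | suc k = let u , uv , du≡k = parent-exists d≡ in u , du≡k , λ _ → uv

  parent : Fin (suc m) → Fin (suc m)
  parent v = proj₁ (parent-step v)

  depth-parent : ∀ v → depth (parent v) ≡ depth v ∸ 1
  depth-parent v = proj₁ (proj₂ (parent-step v))

  parent-adj : ∀ {v} → 0 < depth v → Adj G (parent v) v
  parent-adj {v} = proj₂ (proj₂ (parent-step v))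

  Down : Fin (suc m) → Fin (suc m) → Bool
  Down x y = ⌊ suc (depth x) ≟ depth y ⌋

  downward-edge : Fin (suc m) → Fin (suc m) → ℕ
  downward-edge x y = bit (Down x y ∧ adj G x y)

  downward-edge≡1 : ∀ {x y} → Adj G x y → suc (depth x) ≡ depth y → downward-edge x y ≡ 1
  downward-edge≡1 {x} {y} xy down with suc (depth x) ≟ depth y
  ... | yes _ rewrite xy = refl
  ... | no ¬down = contradiction down ¬down

  downward-edge-positive : ∀ {x y} → 0 < downward-edge x y → Adj G x y
  downward-edge-positive {x} {y} pos with suc (depth x) ≟ depth y | adj G x y
  ... | yes _ | true  = refl
  ... | yes _ | false = contradiction pos λ ()
  ... | no _  | _     = contradiction pos λ ()

  downward-edge≡0 : ∀ {x y} → suc (depth x) ≢ depth y → downward-edge x y ≡ 0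
  downward-edge≡0 {x} {y} ¬down with suc (depth x) ≟ depth y
  ... | yes down = contradiction down ¬down
  ... | no _     = refl

  tree-edge-downward : ∀ y → downward-edge (parent y) y ≡ bit (0 <ᵇ depth y)
  tree-edge-downward y = by-depth (depth y) refl
    where
    by-depth : ∀ k → depth y ≡ k → downward-edge (parent y) y ≡ bit (0 <ᵇ k)
    by-depth zero    d≡0   = downward-edge≡0 λ down → 1+n≢0 (trans down d≡0)
    by-depth (suc k) d≡1+k = downward-edge≡1 (parent-adj (subst (0 <_) (sym d≡1+k) z<s))
      (trans (cong suc (trans (depth-parent y) (cong pred d≡1+k))) (sym d≡1+k))

  ∑-non-root : ∑[ y < suc m ] bit (0 <ᵇ depth y) ≡ m
  ∑-non-root = begin
    ∑[ y < suc m ] bit (0 <ᵇ depth y)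
      ≡⟨ sum-remove {i = r} (λ y → bit (0 <ᵇ depth y)) ⟩
    bit (0 <ᵇ depth r) + ∑[ i < m ] bit (0 <ᵇ depth (punchIn r i))
      ≡⟨ cong₂ _+_ (cong (λ d → bit (0 <ᵇ d)) depth-root) (sum-cong-≗ λ i → non-root (Fin.punchInᵢ≢i r i)) ⟩
    ∑[ i < m ] 1
      ≡⟨ ∑-ones m ⟩
    m ∎
    where
    open ≡-Reasoning
    non-root : ∀ {y} → y ≢ r → bit (0 <ᵇ depth y) ≡ 1
    non-root {y} y≢r with depth y in d≡
    ... | zero  = contradiction (depth≡0⇒root d≡) y≢r
    ... | suc _ = refl

  non-tree-in-degree : Fin (suc m) → ℕ
  non-tree-in-degree y = ∑[ i < m ] downward-edge (punchIn (parent y) i) y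

  in-degree-split : ∀ y → ∑[ x < suc m ] downward-edge x y ≡ bit (0 <ᵇ depth y) + non-tree-in-degree y
  in-degree-split y =
    trans (sum-remove {i = parent y} (λ x → downward-edge x y))
          (cong (_+ non-tree-in-degree y) (tree-edge-downward y))

  Lt : Fin (suc m) → Fin (suc m) → Bool
  Lt i j = toℕ i <ᵇ toℕ j

  Lt-orients : Orients Lt
  Lt-orients = orients Lt total asym
    where
    total : ∀ i j → adj G i j ≡ true → T (Lt i j) ⊎ T (Lt j i)
    total i j ij with <-cmp (toℕ i) (toℕ j)
    ... | tri< i<j _ _ = inj₁ (<⇒<ᵇ i<j)
    ... | tri≈ _ i≡j _ = contradiction (Fin.toℕ-injective i≡j) (adj⇒≢ G ij)
    ... | tri> _ _ j<i = inj₂ (<⇒<ᵇ j<i)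
    asym : ∀ i j → T (Lt i j) → ¬ T (Lt j i)
    asym i j i<j j<i = <-asym (<ᵇ⇒< (toℕ i) (toℕ j) i<j) (<ᵇ⇒< (toℕ j) (toℕ i) j<i)

  Down-orients : Orients Down
  Down-orients = orients Down total asym
    where
    total : ∀ i j → adj G i j ≡ true → T (Down i j) ⊎ T (Down j i)
    total i j ij = Sum.map fromWitness fromWitness (adjacent-depth-step c proper ij)
    asym : ∀ i j → T (Down i j) → ¬ T (Down j i)
    asym i j i→j j→i = <-asym (≤-reflexive (toWitness i→j)) (≤-reflexive (toWitness j→i))

  #non-tree-edges : ∑[ y < suc m ] non-tree-in-degree y ≡ 1
  #non-tree-edges = +-cancelˡ-≡ m _ _ (begin
    m + ∑[ y < suc m ] non-tree-in-degree y
      ≡⟨ cong (_+ ∑[ y < suc m ] non-tree-in-degree y) ∑-non-root ⟨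
    ∑[ y < suc m ] bit (0 <ᵇ depth y) + ∑[ y < suc m ] non-tree-in-degree y
      ≡⟨ ∑-distrib-+ (λ y → bit (0 <ᵇ depth y)) non-tree-in-degree ⟨
    ∑[ y < suc m ] (bit (0 <ᵇ depth y) + non-tree-in-degree y)
      ≡⟨ sum-cong-≗ in-degree-split ⟨
    ∑[ y < suc m ] ∑[ x < suc m ] downward-edge x y
      ≡⟨ ∑-comm downward-edge ⟨
    #oriented Down
      ≡⟨ #oriented-unique Lt Down Lt-orients Down-orients ⟨
    #oriented Lt
      ≡⟨ trans (ΣFin≡∑ (suc m) _) (sum-cong-≗ λ i → ΣFin≡∑ (suc m) (λ j → bit (Lt i j ∧ adj G i j))) ⟨
    numEdges G
      ≡⟨ trans #edges (+-comm 1 m) ⟩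
    m + 1 ∎)
    where open ≡-Reasoning

  non-tree-edge : ∃₂ λ b i → 0 < downward-edge (punchIn (parent b) i) b ×
    ∀ y j → 0 < downward-edge (punchIn (parent y) j) y → y ≡ b × j ≡ i
  non-tree-edge = ∑∑≡1⇒unique-support (λ y i → downward-edge (punchIn (parent y) i) y) #non-tree-edges

  b : Fin (suc m)
  b = proj₁ non-tree-edge

  a : Fin (suc m)
  a = punchIn (parent b) (proj₁ (proj₂ non-tree-edge))

  ab : Adj G a b
  ab = downward-edge-positive (proj₁ (proj₂ (proj₂ non-tree-edge)))

  downward : ∀ {x y} → Adj G x y → suc (depth x) ≡ depth y → x ≡ parent y ⊎ (x ≡ a × y ≡ b)
  downward {x} {y} xy down = Sum.map₂ non-tree (toSum (x Fin.≟ parent y))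
    where
    non-tree : x ≢ parent y → x ≡ a × y ≡ b
    non-tree x≢parent = x≡a , y≡b
      where
      parent≢x : parent y ≢ x
      parent≢x = x≢parent ∘ sym
      counted : 0 < downward-edge (punchIn (parent y) (punchOut parent≢x)) y
      counted = subst (λ z → 0 < downward-edge z y) (sym (Fin.punchIn-punchOut parent≢x))
                  (≤-reflexive (sym (downward-edge≡1 xy down)))
      y≡b×j≡i : y ≡ b × punchOut parent≢x ≡ proj₁ (proj₂ non-tree-edge)
      y≡b×j≡i = proj₂ (proj₂ (proj₂ non-tree-edge)) y (punchOut parent≢x) counted
      y≡b : y ≡ b
      y≡b = proj₁ y≡b×j≡i
      x≡a : x ≡ a
      x≡a = trans (sym (Fin.punchIn-punchOut parent≢x)) (cong₂ punchIn (cong parent y≡b) (proj₂ y≡b×j≡i))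

  orientation : FunctionalOrientation G
  orientation = PathReversal.orientation G r parent depth depth-parent depth≡0⇒root parent-adj
    (adjacent-depth-step c proper) a b ab downward

unicyclic-orientation : (G : SimpleGraph n) → Connected G → Bipartite G → numEdges G ≡ n →
  FunctionalOrientation G
unicyclic-orientation {zero}  G _         _            _      =
  record { from = λ () ; from-adj = λ () ; covers = λ () }
unicyclic-orientation {suc m} G connected (c , proper) #edges =
  UnicyclicOrientation.orientation G zero connected c proper #edges

Tame : (Bool → Bool → Bool) → Set
Tame clash = (∀ α → clash α α ≡ false) ⊎ ∃ λ β → ∀ α → clash α β ≡ false

module FunctionalGraphColouring
  (from : Fin n → Fin n) (clash : Fin n → Bool → Bool → Bool) (tame : ∀ v → Tame (clash v)) where

  copies : Fin n → Bool
  copies v with tame v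
  ... | inj₁ _ = true
  ... | inj₂ _ = false

  copies-inj₁ : ∀ {v d} → tame v ≡ inj₁ d → copies v ≡ true
  copies-inj₁ tame-v rewrite tame-v = refl

  follow : ℕ → Fin n → Bool
  follow zero    v = false
  follow (suc k) v with tame v
  ... | inj₁ _       = follow k (from v)
  ... | inj₂ (β , _) = β

  walk : ℕ → Fin n → Fin n
  walk i v = iterate from v i

  walk-+ : ∀ i t v → walk (i + t) v ≡ walk t (walk i v)
  walk-+ zero    t v = refl
  walk-+ (suc i) t v = walk-+ i t (from v)

  unstable⇒copy-chain : ∀ k v → follow k v ≢ follow (suc k) v →
    (∀ i → i < k → copies (walk i v) ≡ true) × copies (walk k v) ≡ false
  unstable⇒copy-chain zero v unstable with tame v
  ... | inj₁ _ = contradiction refl unstable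
  ... | inj₂ _ = (λ _ ()) , refl
  unstable⇒copy-chain (suc k) v unstable with tame v in tame-v
  ... | inj₂ _ = contradiction refl unstable
  ... | inj₁ _ with unstable⇒copy-chain k (from v) unstable
  ...   | chain , anchored = copying , anchored
    where
    copying : ∀ i → i < suc k → copies (walk i v) ≡ true
    copying zero    _         = copies-inj₁ tame-v
    copying (suc i) (s≤s i<k) = chain i i<k

  follow-stable : ∀ v → follow n v ≡ follow (suc n) v
  follow-stable v with follow n v Bool.≟ follow (suc n) v
  ... | yes stable = stable
  ... | no unstable
    with chain , anchored ← unstable⇒copy-chain n v unstable
    with i , j , i<j , walk-i≡walk-j ← Fin.pigeonhole (n<1+n n) (λ i → walk (toℕ i) v)
    = case trans (sym anchored) (trans (cong copies walk-n≡) (chain (toℕ i + t) i+t<n)) of λ ()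
    where
    t = n ∸ toℕ j
    j+t≡n : toℕ j + t ≡ n
    j+t≡n = m+[n∸m]≡n (Fin.toℕ≤pred[n] j)
    i+t<n : toℕ i + t < n
    i+t<n = subst (toℕ i + t <_) j+t≡n (+-monoˡ-< t i<j)
    walk-n≡ : walk n v ≡ walk (toℕ i + t) v
    walk-n≡ = begin
      walk n v                   ≡⟨ cong (λ k → walk k v) j+t≡n ⟨
      walk (toℕ j + t) v         ≡⟨ walk-+ (toℕ j) t v ⟩
      walk t (walk (toℕ j) v)    ≡⟨ cong (walk t) walk-i≡walk-j ⟨
      walk t (walk (toℕ i) v)    ≡⟨ walk-+ (toℕ i) t v ⟨
      walk (toℕ i + t) v         ∎
      where open ≡-Reasoning

  colour : Fin n → Bool
  colour = follow (suc n)

  colour-proper : ∀ v → clash v (colour (from v)) (colour v) ≡ false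
  colour-proper v with tame v
  ... | inj₁ diagonal =
    subst (λ β → clash v (colour (from v)) β ≡ false) (sym (follow-stable (from v))) (diagonal _)
  ... | inj₂ (_ , safe) = safe _

∀-Bool? : {P : Bool → Set} → (∀ b → Dec (P b)) → Dec (∀ b → P b)
∀-Bool? P? =
  map′ (λ (pf , pt) → λ { false → pf ; true → pt }) (λ p → p false , p true) (P? false ×-dec P? true)

∃-Bool? : {P : Bool → Set} → (∀ b → Dec (P b)) → Dec (∃ P)
∃-Bool? P? = map′ Sum.[ (false ,_) , (true ,_) ] (λ { (false , p) → inj₁ p ; (true , p) → inj₂ p })
  (P? false ⊎-dec P? true)

tame? : ∀ clash → Dec (Tame clash)
tame? clash = ∀-Bool? (λ α → clash α α Bool.≟ false) ⊎-dec ∃-Bool? λ β → ∀-Bool? λ α → clash α β Bool.≟ false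

nonzero : Bool → F₃
nonzero false = suc zero
nonzero true  = suc (suc zero)

avoid : F₃ → Bool → F₃
avoid x α = x -₃ nonzero α

difference-clash : F₃ → F₃ → F₃ → Bool → Bool → Bool → Bool → Bool
difference-clash x y δ cx cy α β = ⌊ avoid x (α xor cx) -₃ avoid y (β xor cy) Fin.≟ δ ⌋

tame-difference-clash : ∀ x y δ c →
  Tame (difference-clash x y δ c (not c)) × Tame (flip (difference-clash y x δ (not c) c))
tame-difference-clash = from-yes
  (Fin.all? λ x → Fin.all? λ y → Fin.all? λ δ → ∀-Bool? λ c →
    tame? (difference-clash x y δ c (not c)) ×-dec tame? (flip (difference-clash y x δ (not c) c)))

avoid-misses : ∀ x δ α → x -₃ avoid (x -₃ δ) α ≢ δ
avoid-misses = from-yes (Fin.all? λ x → Fin.all? λ δ → ∀-Bool? λ α → ¬? (x -₃ avoid (x -₃ δ) α Fin.≟ δ))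

injective⇒surjective : (f : Fin n → Fin n) → Injective _≡_ _≡_ f → ∀ y → ∃ λ x → f x ≡ y
injective⇒surjective {suc m} f f-injective y with Fin.any? (λ x → f x Fin.≟ y)
... | yes hit  = hit
... | no  miss = contradiction (Fin.injective⇒≤ squeeze-injective) (n≮n m)
  where
  y≢f : ∀ x → y ≢ f x
  y≢f x y≡fx = miss (x , sym y≡fx)
  squeeze : Fin (suc m) → Fin m
  squeeze x = punchOut (y≢f x)
  squeeze-injective : Injective _≡_ _≡_ squeeze
  squeeze-injective = f-injective ∘ Fin.punchOut-injective (y≢f _) (y≢f _)

nonempty-of-size : {p : Subset n} → 0 < ∣ p ∣ → Nonempty p
nonempty-of-size {n} {p} 0<∣p∣ with nonempty? p
... | yes nonempty = nonempty
... | no  empty    = contradiction (trans (cong ∣_∣ (Empty-unique empty)) (∣⊥∣≡0 n)) (>⇒≢ 0<∣p∣)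

singletons-colouring : {G : SimpleGraph n} (H : PrimeCover3 G) (choice : Fin n → F₃) →
  (∀ u → choice u ∈ L H u) → (∀ u v → u ≢ v → ¬ E H u (choice u) v (choice v)) → HasHColoring H
singletons-colouring {n} H choice choice∈L independent = (λ u → ⁅ choice u ⁆) , within-lists , independent′ , size
  where
  within-lists : ∀ u j → j ∈ ⁅ choice u ⁆ → j ∈ L H u
  within-lists u j j∈ with refl ← x∈⁅y⁆⇒x≡y _ j∈ = choice∈L u
  independent′ : ∀ u j v k → j ∈ ⁅ choice u ⁆ → k ∈ ⁅ choice v ⁆ → ¬ E H u j v k
  independent′ u j v k j∈ k∈ with refl ← x∈⁅y⁆⇒x≡y _ j∈ | refl ← x∈⁅y⁆⇒x≡y _ k∈ | u Fin.≟ v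
  ... | yes refl = E-irrefl H u (choice u)
  ... | no  u≢v  = independent u v u≢v
  size : ΣFin n (λ u → ∣ ⁅ choice u ⁆ ∣) ≡ n
  size = trans (ΣFin≡∑ n _) (trans (sum-cong-≗ (∣⁅x⁆∣≡1 ∘ choice)) (∑-ones n))

module GoodCoverColouring (G : SimpleGraph n) (connected : Connected G) (bipartite : Bipartite G)
  (#edges : numEdges G ≡ n) (H : PrimeCover3 (K₁∨ G)) (f-cover : IsFCover H fProp) (good : Good H)
  where

  c : Fin n → Bool
  c = proj₁ bipartite

  π : Fin (suc n) → F₃ → F₃
  π = proj₁ good

  universal-list : Nonempty (L H zero)
  universal-list = nonempty-of-size {p = L H zero} (subst (0 <_) (sym (f-cover zero)) z<s)

  c₀ : F₃
  c₀ = proj₁ universal-list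

  c₀∈L : c₀ ∈ L H zero
  c₀∈L = proj₂ universal-list

  -- Junk value zero where u v is not an edge with u before v.
  shift′ : ∀ {u v} → Dec (toℕ u < toℕ v) → Dec (Adj (K₁∨ G) u v) → F₃
  shift′ {u} {v} (yes u<v) (yes uv) = proj₁ (proj₂ (proj₂ good) u v u<v uv)
  shift′         _         _        = zero

  shift : Fin (suc n) → Fin (suc n) → F₃
  shift u v = shift′ (toℕ u <? toℕ v) (adj (K₁∨ G) u v Bool.≟ true)

  shift-spec : ∀ {u v j k} → toℕ u < toℕ v → E H u j v k → π u j -₃ π v k ≡ shift u v
  shift-spec {u} {v} {j} {k} u<v e = by-cases (toℕ u <? toℕ v) (adj (K₁∨ G) u v Bool.≟ true)
    where
    by-cases : ∀ u<v? uv? → π u j -₃ π v k ≡ shift′ u<v? uv?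
    by-cases (yes u<v′) (yes uv) = proj₂ (proj₂ (proj₂ good) u v u<v′ uv) j k e
    by-cases (no u≮v)   _        = contradiction u<v u≮v
    by-cases (yes _)    (no ¬uv) = contradiction (E-adj H u j v k (λ { refl → <-irrefl refl u<v }) e) ¬uv

  forbidden : Fin n → F₃
  forbidden v = π zero c₀ -₃ shift zero (suc v)

  value : Fin n → Bool → F₃
  value v α = avoid (forbidden v) (α xor c v)

  name : Fin n → Bool → F₃
  name v α = proj₁ (injective⇒surjective (π (suc v)) (proj₁ (proj₂ good) (suc v)) (value v α))

  name-spec : ∀ v α → π (suc v) (name v α) ≡ value v α
  name-spec v α = proj₂ (injective⇒surjective (π (suc v)) (proj₁ (proj₂ good) (suc v)) (value v α))

  universal-misses : ∀ v α → ¬ E H zero c₀ (suc v) (name v α)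
  universal-misses v α e = avoid-misses (π zero c₀) (shift zero (suc v)) (α xor c v)
    (trans (cong (π zero c₀ -₃_) (sym (name-spec v α))) (shift-spec z<s e))

  oriented-clash : Bool → Fin n → Fin n → Bool → Bool → Bool
  oriented-clash true  p q = difference-clash (forbidden p) (forbidden q) (shift (suc p) (suc q)) (c p) (c q)
  oriented-clash false p q = flip (difference-clash (forbidden q) (forbidden p) (shift (suc q) (suc p)) (c q) (c p))

  clash : Fin n → Fin n → Bool → Bool → Bool
  clash p q = oriented-clash (toℕ p <ᵇ toℕ q) p q

  E⇒clash : ∀ p q {α β} → p ≢ q → E H (suc p) (name p α) (suc q) (name q β) → T (clash p q α β)
  E⇒clash p q {α} {β} p≢q e = by-order (toℕ p <ᵇ toℕ q) refl
    where
    by-order : ∀ b → (toℕ p <ᵇ toℕ q) ≡ b → T (oriented-clash b p q α β)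
    by-order true p<ᵇq =
      fromWitness (subst₂ (λ s t → s -₃ t ≡ shift (suc p) (suc q)) (name-spec p α) (name-spec q β)
        (shift-spec (s≤s (<ᵇ⇒< (toℕ p) (toℕ q) (subst T (sym p<ᵇq) _))) e))
    by-order false p≮ᵇq =
      fromWitness (subst₂ (λ s t → s -₃ t ≡ shift (suc q) (suc p)) (name-spec q β) (name-spec p α)
        (shift-spec (s≤s q<p) (E-sym H _ _ _ _ e)))
      where
      q<p : toℕ q < toℕ p
      q<p = ≤∧≢⇒< (≮⇒≥ λ p<q → subst T p≮ᵇq (<⇒<ᵇ p<q)) (p≢q ∘ sym ∘ Fin.toℕ-injective)

  tame-clash : ∀ {p q} → Adj G p q → Tame (clash p q)
  tame-clash {p} {q} pq = by-order (toℕ p <ᵇ toℕ q)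
    where
    cq≡ : c q ≡ not (c p)
    cq≡ = Bool.¬-not (proj₂ bipartite p q pq ∘ sym)
    δ⁺ δ⁻ : F₃
    δ⁺ = shift (suc p) (suc q)
    δ⁻ = shift (suc q) (suc p)
    by-order : ∀ b → Tame (oriented-clash b p q)
    by-order true  = subst (λ cq → Tame (difference-clash (forbidden p) (forbidden q) δ⁺ (c p) cq)) (sym cq≡)
                       (proj₁ (tame-difference-clash (forbidden p) (forbidden q) δ⁺ (c p)))
    by-order false = subst (λ cq → Tame (flip (difference-clash (forbidden q) (forbidden p) δ⁻ cq (c p)))) (sym cq≡)
                       (proj₂ (tame-difference-clash (forbidden p) (forbidden q) δ⁻ (c p)))

  open FunctionalOrientation (unicyclic-orientation G connected bipartite #edges)
  open FunctionalGraphColouring from (λ v → clash (from v) v) (λ v → tame-clash (from-adj v))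

  choice : Fin (suc n) → F₃
  choice zero    = c₀
  choice (suc v) = name v (colour v)

  choice∈L : ∀ u → choice u ∈ L H u
  choice∈L zero    = c₀∈L
  choice∈L (suc v) = subst (name v (colour v) ∈_) (sym (∣p∣≡n⇒p≡⊤ (f-cover (suc v)))) ∈⊤

  oriented-edge-free : ∀ {p q} → from q ≡ p → p ≢ q → ¬ E H (suc p) (choice (suc p)) (suc q) (choice (suc q))
  oriented-edge-free {q = q} refl p≢q e = subst T (colour-proper q) (E⇒clash (from q) q p≢q e)

  choice-independent : ∀ u v → u ≢ v → ¬ E H u (choice u) v (choice v)
  choice-independent zero    zero    0≢0 = contradiction refl 0≢0
  choice-independent zero    (suc v) _   = universal-misses v (colour v)
  choice-independent (suc u) zero    _   = universal-misses u (colour u) ∘ E-sym H _ _ _ _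
  choice-independent (suc p) (suc q) p≢q e = Sum.[
      (λ from-q≡p → oriented-edge-free from-q≡p (p≢q ∘ cong suc) e) ,
      (λ from-p≡q → oriented-edge-free from-p≡q (p≢q ∘ cong suc ∘ sym) (E-sym H _ _ _ _ e)) ]
    (covers p q (E-adj H (suc p) _ (suc q) _ p≢q e))

proposition2p3 : (n : ℕ) (G : SimpleGraph n) → Connected G → Bipartite G →
    numEdges G ≡ n →
    (H : PrimeCover3 (K₁∨ G)) → IsFCover H fProp → Good H → HasHColoring H
proposition2p3 n G connected bipartite #edges H f-cover good =
  singletons-colouring H choice choice∈L choice-independent
  where open GoodCoverColouring G connected bipartite #edges H f-cover good
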